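{- Let $F:\mathcal{A}\to\mathcal{C}$ and $G:\mathcal{B}\to\mathcal{C}$ be functors, $\mathcal{G}=(F\downarrow G)$. Assume $\mathcal{A}$ is regular, $F$ preserves monomorphisms, and $F$ has a right adjoint $F^{\star}$ whose counit $\theta:FF^{\star}\to \mathrm{id}_{\mathcal{C}}$ has every component a monomorphism. For each object $(A,f,B)$ of $\mathcal{G}$, let $\hat f:A\to F^{\star}G(B)$ be the unique morphism with $\theta_{G(B)}\circ F(\hat f)=f$, let $\hat f=m_{\hat f}\circ e_{\hat f}$ be an image factorization with $e_{\hat f}:A\to \mathrm{Ran}(\hat f)$ a regular epimorphism and $m_{\hat f}:\mathrm{Ran}(\hat f)\to F^{\star}G(B)$ a monomorphism, and set $\mathcal{S}(A,f,B)=(\mathrm{Ran}(\hat f),\theta_{G(B)}\circ F(m_{\hat f}),B)$ and $Q^{\star}(B)=(F^{\star}G(B),\theta_{G(B)},B)$. Then $\mathcal{S}(A,f,B)$ and $Q^{\star}(B)$ are simple objects and $(m_{\hat f},\mathrm{id}_B):\mathcal{S}(A,f,B)\to Q^{\star}(B)$ is a morphism of the full subcategory $\mathcal{SG}$ of simple objects of $\mathcal{G}$.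
   Context: The comma category $(F\downarrow G)$ has objects $(A,f,B)$ with $f:F(A)\to G(B)$ in $\mathcal{C}$, and morphisms $(\phi,\psi):(A,f,B)\to(A',f',B')$ with $f'\circ F(\phi)=G(\psi)\circ f$. An object $(A,f,B)$ is simple if $f$ is a monomorphism in $\mathcal{C}$; $\mathcal{SG}$ is the full subcategory of simple objects. A regular category has, in particular, (regular epi, mono) image factorizations of every morphism. -}

module Defs where

open import Level using (Level; _⊔_) renaming (suc to lsuc)
open import Data.Product using (Σ; _×_; _,_; proj₁; proj₂)
open import Relation.Binary using (IsEquivalence)

record Category (o ℓ e : Level) : Set (lsuc (o ⊔ ℓ ⊔ e)) where
  infixr 9 _∘_
  infix  4 _≈_
  field
    Obj       : Set o
    _⇒_       : Obj → Obj → Set ℓ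
    _≈_       : ∀ {A B} → A ⇒ B → A ⇒ B → Set e
    id        : ∀ {A} → A ⇒ A
    _∘_       : ∀ {A B C} → B ⇒ C → A ⇒ B → A ⇒ C
    equiv     : ∀ {A B} → IsEquivalence (_≈_ {A} {B})
    assoc     : ∀ {A B C D} {f : A ⇒ B} {g : B ⇒ C} {h : C ⇒ D} →
                (h ∘ g) ∘ f ≈ h ∘ (g ∘ f)
    identityˡ : ∀ {A B} {f : A ⇒ B} → id ∘ f ≈ f
    identityʳ : ∀ {A B} {f : A ⇒ B} → f ∘ id ≈ f
    ∘-resp-≈  : ∀ {A B C} {f h : B ⇒ C} {g i : A ⇒ B} →
                f ≈ h → g ≈ i → f ∘ g ≈ h ∘ i

module _ {o ℓ ℯ} (C : Category o ℓ ℯ) where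
  open Category C

  Mono : ∀ {A B} → A ⇒ B → Set (o ⊔ ℓ ⊔ ℯ)
  Mono {A} f = ∀ {Z} (g h : Z ⇒ A) → f ∘ g ≈ f ∘ h → g ≈ h

  IsCoequalizer : ∀ {K B Q} → K ⇒ B → K ⇒ B → B ⇒ Q → Set (o ⊔ ℓ ⊔ ℯ)
  IsCoequalizer {K} {B} {Q} k₁ k₂ q =
    (q ∘ k₁ ≈ q ∘ k₂) ×
    (∀ {Z} (h : B ⇒ Z) → h ∘ k₁ ≈ h ∘ k₂ →
       Σ (Q ⇒ Z) λ u → (u ∘ q ≈ h) × (∀ (v : Q ⇒ Z) → v ∘ q ≈ h → v ≈ u))

  RegularEpi : ∀ {B Q} → B ⇒ Q → Set (o ⊔ ℓ ⊔ ℯ)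
  RegularEpi {B} q = Σ Obj λ K → Σ (K ⇒ B) λ k₁ → Σ (K ⇒ B) λ k₂ → IsCoequalizer k₁ k₂ q

  IsTerminal : Obj → Set (o ⊔ ℓ ⊔ ℯ)
  IsTerminal T = ∀ (X : Obj) → Σ (X ⇒ T) λ u → ∀ (v : X ⇒ T) → v ≈ u

  IsPullback : ∀ {P X Y Z} → P ⇒ X → P ⇒ Y → X ⇒ Z → Y ⇒ Z → Set (o ⊔ ℓ ⊔ ℯ)
  IsPullback {P} {X} {Y} p₁ p₂ f g =
    (f ∘ p₁ ≈ g ∘ p₂) ×
    (∀ {W} (h₁ : W ⇒ X) (h₂ : W ⇒ Y) → f ∘ h₁ ≈ g ∘ h₂ →
       Σ (W ⇒ P) λ u → (p₁ ∘ u ≈ h₁) × (p₂ ∘ u ≈ h₂) ×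
         (∀ (v : W ⇒ P) → p₁ ∘ v ≈ h₁ → p₂ ∘ v ≈ h₂ → v ≈ u))

  record ImageFactorization {A B} (f : A ⇒ B) : Set (o ⊔ ℓ ⊔ ℯ) where
    field
      Ran       : Obj
      e         : A ⇒ Ran
      m         : Ran ⇒ B
      e-regular : RegularEpi e
      m-mono    : Mono m
      factors   : m ∘ e ≈ f

  record Regular : Set (o ⊔ ℓ ⊔ ℯ) where
    field
      terminal    : Σ Obj IsTerminal
      pullback    : ∀ {X Y Z} (f : X ⇒ Z) (g : Y ⇒ Z) →
                    Σ Obj λ P → Σ (P ⇒ X) λ p₁ → Σ (P ⇒ Y) λ p₂ → IsPullback p₁ p₂ f g
      factorize   : ∀ {A B} (f : A ⇒ B) → ImageFactorization f
      regEpi-stable : ∀ {P X Y Z} {p₁ : P ⇒ X} {p₂ : P ⇒ Y} {f : X ⇒ Z} {g : Y ⇒ Z} →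
                      IsPullback p₁ p₂ f g → RegularEpi g → RegularEpi p₁

record Functor {o ℓ e o′ ℓ′ e′} (C : Category o ℓ e) (D : Category o′ ℓ′ e′)
       : Set (o ⊔ ℓ ⊔ e ⊔ o′ ⊔ ℓ′ ⊔ e′) where
  private
    module C = Category C
    module D = Category D
  field
    F₀ : C.Obj → D.Obj
    F₁ : ∀ {A B} → A C.⇒ B → F₀ A D.⇒ F₀ B
    identity     : ∀ {A} → F₁ (C.id {A}) D.≈ D.id
    homomorphism : ∀ {X Y Z} {f : X C.⇒ Y} {g : Y C.⇒ Z} →
                   F₁ (g C.∘ f) D.≈ F₁ g D.∘ F₁ f
    F-resp-≈     : ∀ {A B} {f g : A C.⇒ B} → f C.≈ g → F₁ f D.≈ F₁ g

PreservesMonos : ∀ {o ℓ e o′ ℓ′ e′} {C : Category o ℓ e} {D : Category o′ ℓ′ e′} →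
                 Functor C D → Set (o ⊔ ℓ ⊔ e ⊔ o′ ⊔ ℓ′ ⊔ e′)
PreservesMonos {C = C} {D} F =
  ∀ {A B} (f : Category._⇒_ C A B) → Mono C f → Mono D (Functor.F₁ F f)

record RightAdjoint {o ℓ e o′ ℓ′ e′} {A : Category o ℓ e} {C : Category o′ ℓ′ e′}
       (F : Functor A C) : Set (o ⊔ ℓ ⊔ e ⊔ o′ ⊔ ℓ′ ⊔ e′) where
  private
    module A = Category A
    module C = Category C
    module F = Functor F
  field
    F⋆        : Functor C A
  private module F⋆ = Functor F⋆
  field
    θ         : ∀ X → F.F₀ (F⋆.F₀ X) C.⇒ X
    θ-natural : ∀ {X Y} (g : X C.⇒ Y) → θ Y C.∘ F.F₁ (F⋆.F₁ g) C.≈ g C.∘ θ X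
    transpose : ∀ {a X} → F.F₀ a C.⇒ X → a A.⇒ F⋆.F₀ X
    transpose-eq : ∀ {a X} (f : F.F₀ a C.⇒ X) → θ X C.∘ F.F₁ (transpose f) C.≈ f
    transpose-unique : ∀ {a X} (f : F.F₀ a C.⇒ X) (g : a A.⇒ F⋆.F₀ X) →
                       θ X C.∘ F.F₁ g C.≈ f → g A.≈ transpose f

module Comma {o₁ ℓ₁ e₁ o₂ ℓ₂ e₂ o₃ ℓ₃ e₃}
  {A : Category o₁ ℓ₁ e₁} {B : Category o₂ ℓ₂ e₂} {C : Category o₃ ℓ₃ e₃}
  (F : Functor A C) (G : Functor B C) where
  private
    module A = Category A
    module B = Category B
    module C = Category C
    module F = Functor F
    module G = Functor G

  record CommaObj : Set (o₁ ⊔ o₂ ⊔ ℓ₃) where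
    constructor comma
    field
      dom : A.Obj
      cod : B.Obj
      arr : F.F₀ dom C.⇒ G.F₀ cod
  open CommaObj public

  IsCommaMorphism : (X Y : CommaObj) → dom X A.⇒ dom Y → cod X B.⇒ cod Y → Set e₃
  IsCommaMorphism X Y φ ψ = arr Y C.∘ F.F₁ φ C.≈ G.F₁ ψ C.∘ arr X

  IsSimple : CommaObj → Set (o₃ ⊔ ℓ₃ ⊔ e₃)
  IsSimple X = Mono C (arr X)

  IsSGMorphism : (X Y : CommaObj) → dom X A.⇒ dom Y → cod X B.⇒ cod Y → Set (o₃ ⊔ ℓ₃ ⊔ e₃)
  IsSGMorphism X Y φ ψ = IsSimple X × IsSimple Y × IsCommaMorphism X Y φ ψ

module Submission where

open import Defs
open import Level using (Level)
open import Data.Product using (_×_; _,_)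
open import Relation.Binary using (IsEquivalence)

-- S(A, f, B) is the comma object θ_{GB} ∘ F m with m mono, so it is simple
-- because F preserves monos and θ is componentwise mono, and (m, id) is a
-- comma morphism into Q⋆(B) by construction.

Mono-∘ : ∀ {o ℓ e} (C : Category o ℓ e) → let open Category C in
  ∀ {X Y Z} {g : Y ⇒ Z} {f : X ⇒ Y} → Mono C g → Mono C f → Mono C (g ∘ f)
Mono-∘ C {f = f} mono-g mono-f a b gfa≈gfb =
  mono-f a b (mono-g (f ∘ a) (f ∘ b) (trans (sym assoc) (trans gfa≈gfb assoc)))
  where
    open Category C
    open IsEquivalence equiv

module _ {o₁ ℓ₁ e₁ o₂ ℓ₂ e₂ o₃ ℓ₃ e₃}
  {𝒜 : Category o₁ ℓ₁ e₁} {ℬ : Category o₂ ℓ₂ e₂} {𝒞 : Category o₃ ℓ₃ e₃}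
  (F : Functor 𝒜 𝒞) (G : Functor ℬ 𝒞) where
  open Category 𝒞
  open Comma F G
  private
    module 𝒜 = Category 𝒜
    module ℬ = Category ℬ
    module F = Functor F
    module G = Functor G

  isCommaMorphism-precompose : ∀ {A A′ B} (f : F.F₀ A′ ⇒ G.F₀ B) (φ : A 𝒜.⇒ A′) →
    IsCommaMorphism (comma A B (f ∘ F.F₁ φ)) (comma A′ B f) φ ℬ.id
  isCommaMorphism-precompose f φ =
    sym (trans (∘-resp-≈ G.identity refl) identityˡ)
    where open IsEquivalence equiv

  isSimple-precompose : ∀ {A A′ B} {f : F.F₀ A′ ⇒ G.F₀ B} {φ : A 𝒜.⇒ A′} →
    PreservesMonos F → Mono 𝒞 f → Mono 𝒜 φ → IsSimple (comma A B (f ∘ F.F₁ φ))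
  isSimple-precompose {φ = φ} preserves mono-f mono-φ =
    Mono-∘ 𝒞 mono-f (preserves φ mono-φ)

-- Regularity of 𝒜 is what guarantees that the image factorization exists.
mainTheorem3 : ∀ {o₁ ℓ₁ e₁ o₂ ℓ₂ e₂ o₃ ℓ₃ e₃ : Level}
    {𝒜 : Category o₁ ℓ₁ e₁} {ℬ : Category o₂ ℓ₂ e₂} {𝒞 : Category o₃ ℓ₃ e₃}
    (F : Functor 𝒜 𝒞) (G : Functor ℬ 𝒞) →
    Regular 𝒜 →
    PreservesMonos F →
    (adj : RightAdjoint F) →
    (∀ X → Mono 𝒞 (RightAdjoint.θ adj X)) →
    (X : Comma.CommaObj F G) →
    (fact : ImageFactorization 𝒜 (RightAdjoint.transpose adj (Comma.arr X))) →
    let B = Comma.cod X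
        θGB = RightAdjoint.θ adj (Functor.F₀ G B)
        m = ImageFactorization.m fact
        S = Comma.comma (ImageFactorization.Ran fact) B
              (Category._∘_ 𝒞 θGB (Functor.F₁ F m))
        Q⋆ = Comma.comma (Functor.F₀ (RightAdjoint.F⋆ adj) (Functor.F₀ G B)) B θGB
    in Comma.IsSimple F G S × Comma.IsSimple F G Q⋆ ×
       Comma.IsSGMorphism F G S Q⋆ m (Category.id ℬ)
mainTheorem3 F G _ preserves adj θ-mono X fact =
  simple-S , simple-Q⋆ , simple-S , simple-Q⋆ ,
  isCommaMorphism-precompose F G θGB m
  where
    open ImageFactorization fact using (m; m-mono)
    GB = Functor.F₀ G (Comma.cod X)
    θGB = RightAdjoint.θ adj GB
    simple-S = isSimple-precompose F G preserves (θ-mono GB) m-mono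
    simple-Q⋆ = θ-mono GB
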